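{- Let $D_0$ be a two-row diagram whose nonempty rows are $r_1<r_2$. Then $\mathcal{P}(D_0)$ is bounded if and only if either $r_1=1$, or $r_1>1$ and $\mathrm{Col}^{\leftarrow}(D_0;r_1)=\emptyset$.
   Context: A diagram is a finite set $D$ of cells $(r,c)$ with $r,c$ positive integers; $r$ is the row (rows numbered from bottom to top starting at 1) and $c$ the column (numbered from left to right starting at 1). A Kohnert move at row $r$ applied to a diagram $D$: if row $r$ of $D$ is empty, $D$ is unchanged; otherwise let $(r,c)$ be the cell of row $r$ with the largest column index; if every position $(r',c)$ with $1\le r'<r$ belongs to $D$, then $D$ is unchanged; otherwise let $r'$ be the largest integer with $1\le r'<r$ and $(r',c)\notin D$, and the move replaces the cell $(r,c)$ by $(r',c)$. For a diagram $D_0$, $KD(D_0)$ is the set of all diagrams obtainable from $D_0$ by finite (possibly empty) sequences of Kohnert moves; the Kohnert poset $\mathcal{P}(D_0)$ is $KD(D_0)$ ordered by $D_2\preceq D_1$ iff $D_2$ can be obtained from $D_1$ by a finite sequence of Kohnert moves. A finite poset is bounded if it has a unique minimal element and a unique maximal element. A two-row diagram is a diagram with exactly two nonempty rows (not necessarily consecutive). For such $D_0$ with nonempty rows $r_1<r_2$: $\mathrm{Col}(D_0;r_1,r_2)$ is the set of columns containing cells in both rows; $\mathrm{Col}(D_0;r_1)$ is the set of columns containing a cell only in row $r_1$; $\mathrm{Col}^{\leftarrow}(D_0;r_1)=\{c\in\mathrm{Col}(D_0;r_1): c<\max\mathrm{Col}(D_0;r_1,r_2)\}$, taken to be empty when $\mathrm{Col}(D_0;r_1,r_2)=\emptyset$.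 -}

module Defs where

open import Data.Nat using (ℕ; zero; suc; _∸_; _<_; _≤_; _⊔_)
open import Data.Nat.Properties using (_≟_)
open import Data.Product using (_×_; _,_; proj₁; proj₂; Σ; ∃; ∃-syntax)
open import Data.Product.Properties using (≡-dec)
open import Data.Sum using (_⊎_)
open import Data.List using (List; []; _∷_; map; filter)
open import Data.List.Membership.Propositional using (_∈_; _∉_)
open import Data.List.Membership.DecPropositional (≡-dec _≟_ _≟_) using () renaming (_∈?_ to _∈?ᶜ_)
open import Data.Maybe using (Maybe; just; nothing)
open import Relation.Nullary using (¬_; yes; no; ¬?)
open import Relation.Binary.PropositionalEquality using (_≡_)
open import Function.Bundles using (_⇔_)

-- A cell (r , c): r = row (bottom to top, from 1), c = column (from 1).
Cell : Set
Cell = ℕ × ℕ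

-- A diagram is a finite set of cells, represented by a list of cells;
-- two lists represent the same diagram iff they have the same members.
Diagram : Set
Diagram = List Cell

_≈_ : Diagram → Diagram → Set
D ≈ E = ∀ (x : Cell) → (x ∈ D) ⇔ (x ∈ E)

rowCols : Diagram → ℕ → List ℕ
rowCols D r = map proj₂ (filter (λ p → proj₁ p ≟ r) D)

maxList : List ℕ → Maybe ℕ
maxList [] = nothing
maxList (x ∷ xs) with maxList xs
... | nothing = just x
... | just m = just (x ⊔ m)

findGap : Diagram → ℕ → ℕ → Maybe ℕ
findGap D c zero = nothing
findGap D c (suc k) with (suc k , c) ∈?ᶜ D
... | yes _ = findGap D c k
... | no  _ = just (suc k)

removeCell : Cell → Diagram → Diagram
removeCell x D = filter (λ p → ¬? (≡-dec _≟_ _≟_ p x)) D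

kohnertMove : ℕ → Diagram → Diagram
kohnertMove r D with maxList (rowCols D r)
... | nothing = D
... | just c with findGap D c (r ∸ 1)
...   | nothing = D
...   | just r' = (r' , c) ∷ removeCell (r , c) D

applyMoves : List ℕ → Diagram → Diagram
applyMoves [] D = D
applyMoves (r ∷ rs) D = applyMoves rs (kohnertMove r D)

_⪯_ : Diagram → Diagram → Set
D₂ ⪯ D₁ = ∃[ rs ] (D₂ ≈ applyMoves rs D₁)

InKD : Diagram → Diagram → Set
InKD D₀ D = D ⪯ D₀

IsMinimal : Diagram → Diagram → Set
IsMinimal D₀ M = InKD D₀ M × (∀ D → InKD D₀ D → D ⪯ M → D ≈ M)

IsMaximal : Diagram → Diagram → Set
IsMaximal D₀ M = InKD D₀ M × (∀ D → InKD D₀ D → M ⪯ D → D ≈ M)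

Bounded : Diagram → Set
Bounded D₀ =
  (∃[ m ] (IsMinimal D₀ m × (∀ m' → IsMinimal D₀ m' → m' ≈ m))) ×
  (∃[ M ] (IsMaximal D₀ M × (∀ M' → IsMaximal D₀ M' → M' ≈ M)))

TwoRowDiagram : Diagram → ℕ → ℕ → Set
TwoRowDiagram D r₁ r₂ =
  (∀ r c → (r , c) ∈ D → 1 ≤ r × 1 ≤ c) ×
  (∀ r c → (r , c) ∈ D → r ≡ r₁ ⊎ r ≡ r₂) ×
  (∃[ c ] (r₁ , c) ∈ D) × (∃[ c ] (r₂ , c) ∈ D) × r₁ < r₂

InColBoth : Diagram → ℕ → ℕ → ℕ → Set
InColBoth D r₁ r₂ c = (r₁ , c) ∈ D × (r₂ , c) ∈ D

InColOnly : Diagram → ℕ → ℕ → ℕ → Set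
InColOnly D r₁ r₂ c = (r₁ , c) ∈ D × (r₂ , c) ∉ D

-- Col^←(D;r₁): c ∈ Col(D;r₁) with c < max Col(D;r₁,r₂)
-- (c < max S unfolded as: some element of S exceeds c; empty when S = ∅)
InColLeft : Diagram → ℕ → ℕ → ℕ → Set
InColLeft D r₁ r₂ c = InColOnly D r₁ r₂ c × ∃[ c' ] (InColBoth D r₁ r₂ c' × c < c')

ColLeftEmpty : Diagram → ℕ → ℕ → Set
ColLeftEmpty D r₁ r₂ = ∀ c → ¬ InColLeft D r₁ r₂ c

-- Kohnert moves keep every cell in its column, so a diagram reachable from the two-row
-- diagram D₀ is described by the rows lo c ≤ hi c of the one or two cells of each column c.
-- Along moves lo and hi only decrease, which makes D₀ the unique maximal element; moreover
-- a one-cell column a left of a two-cell column b with hi b ≤ lo a keeps this property.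
-- A diagram admitting no move has all cells in rows 1 and 2, its two-cell columns fill both,
-- and each cell in row 2 has a two-cell column weakly to its right. Hence in a minimal
-- element a column with a cell only in row r₂ lies in row 2 exactly when a two-cell column
-- lies to its right, and under the condition a column with a cell only in row r₁ lies in
-- row 1, so the minimal element is unique. Conversely, if r₁ > 1 and c ∈ Col^←(D₀;r₁) lies
-- left of the two-cell column c', lowering all row-r₁ cells to row 1 leads to a minimal
-- element containing (1,c), while lowering only the cells right of c' - 1, from row r₁ to
-- row 1 and then from row r₂ to row r₁, puts column c' weakly below c, which keeps c off
-- row 1 in every minimal element below.

module Submission where

open import Defs
open import Data.Nat using (ℕ; zero; suc; _+_; _∸_; _<_; _≤_; _>_; _⊓_; _⊔_; z≤n; s≤s)
open import Data.Nat.Properties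
open import Data.Nat.Induction using (<-wellFounded)
open import Data.Product using (_×_; _,_; proj₁; proj₂; ∃-syntax)
open import Data.Product.Properties using (≡-dec)
open import Data.Sum using (_⊎_; inj₁; inj₂; [_,_]′; map₂; swap)
open import Data.Empty using (⊥; ⊥-elim)
open import Data.List using (List; []; _∷_; _++_)
open import Data.List.Membership.Propositional using (_∈_; _∉_)
open import Data.List.Membership.Propositional.Properties
  using (∈-filter⁺; ∈-filter⁻; ∈-map∘filter⁺; ∈-map∘filter⁻)
open import Data.List.Membership.DecPropositional (≡-dec _≟_ _≟_) using () renaming (_∈?_ to _∈?ᶜ_)
open import Data.List.Relation.Unary.Any using (here; there)
open import Data.Maybe using (just; nothing)
open import Induction.WellFounded using (Acc; acc)
open import Relation.Nullary using (¬_; yes; no; ¬?)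
open import Relation.Nullary.Decidable using (_×-dec_)
open import Relation.Unary using (Decidable)
open import Relation.Binary.Definitions using (tri<; tri≈; tri>)
open import Relation.Binary.PropositionalEquality
open import Function.Base using (_∘_)
open import Function.Bundles using (_⇔_; mk⇔; Equivalence)
open import Function.Construct.Composition using (_⇔-∘_)
open import Function.Construct.Identity using (⇔-id)
open import Function.Construct.Symmetry using (⇔-sym)

-- Kohnert moves

∈-rowCols⁻ : ∀ {D r c} → c ∈ rowCols D r → (r , c) ∈ D
∈-rowCols⁻ {D} {r} m with ∈-map∘filter⁻ proj₂ (λ p → proj₁ p ≟ r) {xs = D} m
... | _ , x∈D , refl , refl = x∈D

∈-rowCols⁺ : ∀ {D r c} → (r , c) ∈ D → c ∈ rowCols D r
∈-rowCols⁺ {D} {r} m = ∈-map∘filter⁺ proj₂ (λ p → proj₁ p ≟ r) {xs = D} (_ , m , refl , refl)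

∈-removeCell⁻ : ∀ {x y D} → x ∈ removeCell y D → x ∈ D × x ≢ y
∈-removeCell⁻ {y = y} = ∈-filter⁻ (λ p → ¬? (≡-dec _≟_ _≟_ p y))

∈-removeCell⁺ : ∀ {x y D} → x ∈ D → x ≢ y → x ∈ removeCell y D
∈-removeCell⁺ {y = y} = ∈-filter⁺ (λ p → ¬? (≡-dec _≟_ _≟_ p y))

maxList-nothing : ∀ {L x} → maxList L ≡ nothing → x ∉ L
maxList-nothing {y ∷ L} e with maxList L
maxList-nothing {y ∷ L} () | nothing
maxList-nothing {y ∷ L} () | just _

maxList-just : ∀ {L m} → maxList L ≡ just m → m ∈ L × (∀ {x} → x ∈ L → x ≤ m)
maxList-just {y ∷ L} e with maxList L in eq
maxList-just {y ∷ L} refl | nothing =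
  here refl , λ { (here refl) → ≤-refl ; (there x∈L) → ⊥-elim (maxList-nothing eq x∈L) }
maxList-just {y ∷ L} refl | just m with maxList-just eq | ⊔-sel y m
... | m∈L , bound | sel =
  ⊔∈ sel , λ { (here refl) → m≤m⊔n y m ; (there x∈L) → m≤n⇒m≤o⊔n y (bound x∈L) }
  where
  ⊔∈ : y ⊔ m ≡ y ⊎ y ⊔ m ≡ m → y ⊔ m ∈ y ∷ L
  ⊔∈ (inj₁ e) rewrite e = here refl
  ⊔∈ (inj₂ e) rewrite e = there m∈L

record RowMax (D : Diagram) (r c : ℕ) : Set where
  field
    cell : (r , c) ∈ D
    rightmost : ∀ {c'} → (r , c') ∈ D → c' ≤ c

record TopGap (D : Diagram) (c r r' : ℕ) : Set where
  field
    positive : 1 ≤ r'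
    below : r' < r
    free : (r' , c) ∉ D
    filled : ∀ {k} → r' < k → k < r → (k , c) ∈ D

FilledBelow : Diagram → ℕ → ℕ → Set
FilledBelow D c r = ∀ {k} → 1 ≤ k → k < r → (k , c) ∈ D

Blocked : Diagram → ℕ → Set
Blocked D r = ∀ {c} → (r , c) ∈ D → ∃[ c* ] (RowMax D r c* × FilledBelow D c* r)

maxList-rowCols : ∀ {D r c} → maxList (rowCols D r) ≡ just c → RowMax D r c
maxList-rowCols e with maxList-just e
... | c∈ , bound = record { cell = ∈-rowCols⁻ c∈ ; rightmost = λ m → bound (∈-rowCols⁺ m) }

findGap-nothing : ∀ {D c} r → findGap D c (r ∸ 1) ≡ nothing → FilledBelow D c r
findGap-nothing {D} {c} (suc r) = go r
  where
  go : ∀ n → findGap D c n ≡ nothing → FilledBelow D c (suc n)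
  go zero _ 1≤k (s≤s k≤0) = ⊥-elim (<⇒≱ 1≤k k≤0)
  go (suc n) e {k} 1≤k k<2+n with (suc n , c) ∈?ᶜ D
  ... | yes top with m≤n⇒m<n∨m≡n (≤-pred k<2+n)
  ...   | inj₁ k<1+n = go n e 1≤k k<1+n
  ...   | inj₂ refl = top
  go (suc n) () 1≤k k<2+n | no _
findGap-nothing zero _ _ ()

findGap-just : ∀ {D c r'} r → findGap D c (r ∸ 1) ≡ just r' → TopGap D c r r'
findGap-just {D} {c} {r'} (suc r) = go r
  where
  go : ∀ n → findGap D c n ≡ just r' → TopGap D c (suc n) r'
  go zero ()
  go (suc n) e with (suc n , c) ∈?ᶜ D
  go (suc n) e | yes top = record
    { positive = positive ; below = m<n⇒m<1+n below ; free = free ; filled = filled' }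
    where
    open TopGap (go n e)
    filled' : ∀ {k} → r' < k → k < suc (suc n) → (k , c) ∈ D
    filled' r'<k k<2+n with m≤n⇒m<n∨m≡n (≤-pred k<2+n)
    ... | inj₁ k<1+n = filled r'<k k<1+n
    ... | inj₂ refl = top
  go (suc n) refl | no gap = record
    { positive = s≤s z≤n ; below = ≤-refl ; free = gap
    ; filled = λ r'<k k≤ → ⊥-elim (<⇒≱ r'<k (≤-pred k≤)) }
findGap-just zero ()

data Move (r : ℕ) (D : Diagram) : Diagram → Set where
  blocked : Blocked D r → Move r D D
  moves : ∀ {c r'} → RowMax D r c → TopGap D c r r' → Move r D ((r' , c) ∷ removeCell (r , c) D)

move : ∀ r D → Move r D (kohnertMove r D)
move r D with maxList (rowCols D r) in maxEq
... | nothing = blocked λ m → ⊥-elim (maxList-nothing maxEq (∈-rowCols⁺ m))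
... | just c with findGap D c (r ∸ 1) in gapEq
...   | nothing = blocked λ _ → c , maxList-rowCols maxEq , findGap-nothing r gapEq
...   | just r' = moves (maxList-rowCols maxEq) (findGap-just r gapEq)

≈-refl : ∀ {D} → D ≈ D
≈-refl x = ⇔-id _

≈-sym : ∀ {D E} → D ≈ E → E ≈ D
≈-sym D≈E x = ⇔-sym (D≈E x)

≈-trans : ∀ {D E F} → D ≈ E → E ≈ F → D ≈ F
≈-trans D≈E E≈F x = E≈F x ⇔-∘ D≈E x

≡⇒≈ : ∀ {D E} → D ≡ E → D ≈ E
≡⇒≈ refl = ≈-refl

≈⇒⊆ : ∀ {D E x} → D ≈ E → x ∈ D → x ∈ E
≈⇒⊆ {x = x} D≈E = Equivalence.to (D≈E x)

RowMax-unique : ∀ {D r c c'} → RowMax D r c → RowMax D r c' → c ≡ c'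
RowMax-unique m m' = ≤-antisym (RowMax.rightmost m' (RowMax.cell m)) (RowMax.rightmost m (RowMax.cell m'))

TopGap-unique : ∀ {D c r a b} → TopGap D c r a → TopGap D c r b → a ≡ b
TopGap-unique {a = a} {b} g g' with <-cmp a b
... | tri< a<b _ _ = ⊥-elim (TopGap.free g' (TopGap.filled g a<b (TopGap.below g')))
... | tri≈ _ a≡b _ = a≡b
... | tri> _ _ b<a = ⊥-elim (TopGap.free g (TopGap.filled g' b<a (TopGap.below g)))

RowMax-resp : ∀ {D E r c} → D ≈ E → RowMax D r c → RowMax E r c
RowMax-resp D≈E m = record
  { cell = ≈⇒⊆ D≈E (RowMax.cell m) ; rightmost = λ m' → RowMax.rightmost m (≈⇒⊆ (≈-sym D≈E) m') }

TopGap-resp : ∀ {D E c r r'} → D ≈ E → TopGap D c r r' → TopGap E c r r'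
TopGap-resp D≈E g = record
  { positive = TopGap.positive g ; below = TopGap.below g
  ; free = TopGap.free g ∘ ≈⇒⊆ (≈-sym D≈E) ; filled = λ a b → ≈⇒⊆ D≈E (TopGap.filled g a b) }

moving⇒¬Blocked : ∀ {D r c r'} → RowMax D r c → TopGap D c r r' → ¬ Blocked D r
moving⇒¬Blocked m g blk with blk (RowMax.cell m)
... | c* , m* , full rewrite RowMax-unique m* m =
  TopGap.free g (full (TopGap.positive g) (TopGap.below g))

moved-resp : ∀ {D E x y} → D ≈ E → (x ∷ removeCell y D) ≈ (x ∷ removeCell y E)
moved-resp {D} {E} {x} {y} D≈E = λ z → mk⇔ (transport D≈E) (transport (≈-sym D≈E))
  where
  transport : ∀ {D E z} → D ≈ E → z ∈ x ∷ removeCell y D → z ∈ x ∷ removeCell y E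
  transport _ (here refl) = here refl
  transport D≈E (there m) with ∈-removeCell⁻ m
  ... | z∈D , z≢y = there (∈-removeCell⁺ (≈⇒⊆ D≈E z∈D) z≢y)

kohnertMove-resp : ∀ r {D E} → D ≈ E → kohnertMove r D ≈ kohnertMove r E
kohnertMove-resp r {D} {E} D≈E with kohnertMove r D | move r D | kohnertMove r E | move r E
... | _ | blocked _ | _ | blocked _ = D≈E
... | _ | blocked bD | _ | moves m g =
  ⊥-elim (moving⇒¬Blocked (RowMax-resp (≈-sym D≈E) m) (TopGap-resp (≈-sym D≈E) g) bD)
... | _ | moves m g | _ | blocked bE =
  ⊥-elim (moving⇒¬Blocked (RowMax-resp D≈E m) (TopGap-resp D≈E g) bE)
... | _ | moves m g | _ | moves m' g'
  with RowMax-unique (RowMax-resp D≈E m) m'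
... | refl with TopGap-unique (TopGap-resp D≈E g) g'
... | refl = moved-resp D≈E

applyMoves-resp : ∀ rs {D E} → D ≈ E → applyMoves rs D ≈ applyMoves rs E
applyMoves-resp [] D≈E = D≈E
applyMoves-resp (r ∷ rs) D≈E = applyMoves-resp rs (kohnertMove-resp r D≈E)

applyMoves-++ : ∀ rs ss D → applyMoves (rs ++ ss) D ≡ applyMoves ss (applyMoves rs D)
applyMoves-++ [] ss D = refl
applyMoves-++ (r ∷ rs) ss D = applyMoves-++ rs ss (kohnertMove r D)

-- Minimal elements

Stuck : Diagram → Set
Stuck D = ∀ r → Blocked D r

Stuck⇒kohnertMove≡ : ∀ {D} r → Stuck D → kohnertMove r D ≡ D
Stuck⇒kohnertMove≡ {D} r st with kohnertMove r D | move r D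
... | _ | blocked _ = refl
... | _ | moves m g = ⊥-elim (moving⇒¬Blocked m g (st r))

Stuck⇒applyMoves≡ : ∀ {D} rs → Stuck D → applyMoves rs D ≡ D
Stuck⇒applyMoves≡ [] st = refl
Stuck⇒applyMoves≡ (r ∷ rs) st rewrite Stuck⇒kohnertMove≡ r st = Stuck⇒applyMoves≡ rs st

fixed⇒Blocked : ∀ {D} r → kohnertMove r D ≈ D → Blocked D r
fixed⇒Blocked {D} r fixed with kohnertMove r D | move r D
... | _ | blocked b = b
... | _ | moves m g = ⊥-elim (TopGap.free g (≈⇒⊆ fixed (here refl)))

sumBy : (Cell → ℕ) → Diagram → ℕ
sumBy f [] = 0
sumBy f (x ∷ D) = f x + sumBy f D

∈⇒≤sumBy : ∀ f {D x} → x ∈ D → f x ≤ sumBy f D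
∈⇒≤sumBy f {y ∷ D} (here refl) = m≤m+n (f y) (sumBy f D)
∈⇒≤sumBy f {y ∷ D} (there m) = ≤-trans (∈⇒≤sumBy f m) (m≤n+m (sumBy f D) (f y))

rowSum : Diagram → ℕ
rowSum = sumBy proj₁

rowSum-removeCell≤ : ∀ x D → rowSum (removeCell x D) ≤ rowSum D
rowSum-removeCell≤ x [] = ≤-refl
rowSum-removeCell≤ x (y ∷ D) with ≡-dec _≟_ _≟_ y x
... | yes _ = ≤-trans (rowSum-removeCell≤ x D) (m≤n+m (rowSum D) (proj₁ y))
... | no _ = +-monoʳ-≤ (proj₁ y) (rowSum-removeCell≤ x D)

rowSum-removeCell : ∀ {x D} → x ∈ D → rowSum (removeCell x D) + proj₁ x ≤ rowSum D
rowSum-removeCell {x} {y ∷ D} x∈ with ≡-dec _≟_ _≟_ y x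
... | yes refl =
  ≤-trans (+-monoˡ-≤ (proj₁ x) (rowSum-removeCell≤ x D)) (≤-reflexive (+-comm (rowSum D) (proj₁ x)))
... | no y≢x with x∈
...   | here x≡y = ⊥-elim (y≢x (sym x≡y))
...   | there x∈D = ≤-trans (≤-reflexive (+-assoc (proj₁ y) _ (proj₁ x)))
                            (+-monoʳ-≤ (proj₁ y) (rowSum-removeCell x∈D))

rowSum-moved : ∀ {D r c r'} → (r , c) ∈ D → r' < r → rowSum ((r' , c) ∷ removeCell (r , c) D) < rowSum D
rowSum-moved {D} {r} {c} {r'} m r'<r = begin-strict
  r' + rowSum (removeCell (r , c) D) <⟨ +-monoˡ-< _ r'<r ⟩
  r + rowSum (removeCell (r , c) D)  ≡⟨ +-comm r _ ⟩
  rowSum (removeCell (r , c) D) + r  ≤⟨ rowSum-removeCell m ⟩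
  rowSum D                           ∎
  where open ≤-Reasoning

blocked-or-descends : ∀ r D → Blocked D r ⊎ rowSum (kohnertMove r D) < rowSum D
blocked-or-descends r D with kohnertMove r D | move r D
... | _ | blocked b = inj₁ b
... | _ | moves m g = inj₂ (rowSum-moved (RowMax.cell m) (TopGap.below g))

stuck-or-descends : ∀ D → Stuck D ⊎ ∃[ r ] rowSum (kohnertMove r D) < rowSum D
stuck-or-descends D = scan (suc (rowSum D)) λ rowSum<r m → ⊥-elim (<⇒≱ rowSum<r (∈⇒≤sumBy proj₁ m))
  where
  scan : ∀ n → (∀ {r} → n ≤ r → Blocked D r) → Stuck D ⊎ ∃[ r ] rowSum (kohnertMove r D) < rowSum D
  scan zero above = inj₁ λ r → above z≤n
  scan (suc n) above with blocked-or-descends n D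
  ... | inj₂ descends = inj₂ (n , descends)
  ... | inj₁ b = scan n above'
    where
    above' : ∀ {r} → n ≤ r → Blocked D r
    above' n≤r with m≤n⇒m<n∨m≡n n≤r
    ... | inj₁ n<r = above n<r
    ... | inj₂ refl = b

reach-Stuck : ∀ D → ∃[ ss ] Stuck (applyMoves ss D)
reach-Stuck D = go D (<-wellFounded (rowSum D))
  where
  go : ∀ D → Acc _<_ (rowSum D) → ∃[ ss ] Stuck (applyMoves ss D)
  go D (acc smaller) with stuck-or-descends D
  ... | inj₁ st = [] , st
  ... | inj₂ (r , descends) with go (kohnertMove r D) (smaller descends)
  ...   | ss , st = r ∷ ss , st

row1-kohnertMove : ∀ {D c} r → (1 , c) ∈ D → (1 , c) ∈ kohnertMove r D
row1-kohnertMove {D} r m with kohnertMove r D | move r D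
... | _ | blocked _ = m
... | _ | moves _ g = there (∈-removeCell⁺ m λ eq →
  <⇒≢ (≤-trans (s≤s (TopGap.positive g)) (TopGap.below g)) (cong proj₁ eq))

row1-applyMoves : ∀ {D c} rs → (1 , c) ∈ D → (1 , c) ∈ applyMoves rs D
row1-applyMoves [] m = m
row1-applyMoves (r ∷ rs) m = row1-applyMoves rs (row1-kohnertMove r m)

Stuck⇒IsMinimal : ∀ {D₀ M} → InKD D₀ M → Stuck M → IsMinimal D₀ M
Stuck⇒IsMinimal M∈ st = M∈ , λ { D _ (ts , D≈) → ≈-trans D≈ (≡⇒≈ (Stuck⇒applyMoves≡ ts st)) }

IsMinimal⇒Stuck : ∀ {D₀ M} → IsMinimal D₀ M → Stuck M
IsMinimal⇒Stuck {D₀} {M} ((rs , M≈) , minimal) r =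
  fixed⇒Blocked r (minimal (kohnertMove r M) reachable (r ∷ [] , ≈-refl))
  where
  reachable : InKD D₀ (kohnertMove r M)
  reachable = rs ++ r ∷ [] , ≈-trans (kohnertMove-resp r M≈) (≡⇒≈ (sym (applyMoves-++ rs (r ∷ []) D₀)))

minimal-below : ∀ D₀ rs →
  ∃[ ss ] (IsMinimal D₀ (applyMoves ss (applyMoves rs D₀)) × Stuck (applyMoves ss (applyMoves rs D₀)))
minimal-below D₀ rs with reach-Stuck (applyMoves rs D₀)
... | ss , stuck = ss , Stuck⇒IsMinimal (rs ++ ss , ≡⇒≈ (sym (applyMoves-++ rs ss D₀))) stuck , stuck

-- Lowering cells column by column

CellPred : Set₁
CellPred = ℕ → ℕ → Set

Realises : Diagram → CellPred → Set
Realises E P = ∀ {k c} → (k , c) ∈ E ⇔ P k c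

Reaches : Diagram → CellPred → Set
Reaches D P = ∃[ rs ] Realises (applyMoves rs D) P

_+[_,_] : CellPred → ℕ → ℕ → CellPred
(P +[ j , d ]) k c = P k c ⊎ (k , c) ≡ (j , d)

Reaches-resp : ∀ {D P Q} → (∀ {k c} → P k c ⇔ Q k c) → Reaches D P → Reaches D Q
Reaches-resp P⇔Q (rs , real) =
  rs , mk⇔ (Equivalence.to P⇔Q ∘ Equivalence.to real) (Equivalence.from real ∘ Equivalence.from P⇔Q)

TopGap-oneDown : ∀ {D d j} → 1 ≤ j → (j , d) ∉ D → TopGap D d (suc j) j
TopGap-oneDown 1≤j gap = record
  { positive = 1≤j ; below = ≤-refl ; free = gap
  ; filled = λ j<k k≤j → ⊥-elim (<⇒≱ j<k (≤-pred k≤j)) }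

kohnertMove-drop : ∀ {D j d} → RowMax D (suc j) d → 1 ≤ j → (j , d) ∉ D →
  kohnertMove (suc j) D ≡ (j , d) ∷ removeCell (suc j , d) D
kohnertMove-drop {D} {j} {d} m 1≤j gap with kohnertMove (suc j) D | move (suc j) D
... | _ | blocked b = ⊥-elim (moving⇒¬Blocked m (TopGap-oneDown 1≤j gap) b)
... | _ | moves m' g with RowMax-unique m' m
... | refl with TopGap-unique g (TopGap-oneDown 1≤j gap)
... | refl = refl

slide-step : ∀ {D₀} (P : CellPred) d j → 1 ≤ j → ¬ P (suc j) d → ¬ P j d →
  (∀ {c} → P (suc j) c → c ≤ d) →
  Reaches D₀ (P +[ suc j , d ]) → Reaches D₀ (P +[ j , d ])
slide-step {D₀} P d j 1≤j ¬top ¬bottom right (rs , real) = rs ++ suc j ∷ [] , realises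
  where
  E = applyMoves rs D₀
  rowMax : RowMax E (suc j) d
  rowMax = record
    { cell = Equivalence.from real (inj₂ refl)
    ; rightmost = λ m → [ right , (λ { refl → ≤-refl }) ]′ (Equivalence.to real m) }
  gap : (j , d) ∉ E
  gap m = [ ¬bottom , (λ ()) ]′ (Equivalence.to real m)
  after : applyMoves (rs ++ suc j ∷ []) D₀ ≡ (j , d) ∷ removeCell (suc j , d) E
  after = trans (applyMoves-++ rs (suc j ∷ []) D₀) (kohnertMove-drop rowMax 1≤j gap)
  to : ∀ {k c} → (k , c) ∈ (j , d) ∷ removeCell (suc j , d) E → (P +[ j , d ]) k c
  to (here refl) = inj₂ refl
  to (there m) with ∈-removeCell⁻ m
  ... | m' , moved with Equivalence.to real m'
  ...   | inj₁ p = inj₁ p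
  ...   | inj₂ same = ⊥-elim (moved same)
  from : ∀ {k c} → (P +[ j , d ]) k c → (k , c) ∈ (j , d) ∷ removeCell (suc j , d) E
  from (inj₂ refl) = here refl
  from (inj₁ p) = there (∈-removeCell⁺ (Equivalence.from real (inj₁ p)) λ { refl → ¬top p })
  realises : Realises (applyMoves (rs ++ suc j ∷ []) D₀) (P +[ j , d ])
  realises rewrite after = mk⇔ to from

slide : ∀ {D₀} (P : CellPred) d {lo hi} → 1 ≤ lo → lo ≤ hi →
  (∀ {k} → lo ≤ k → k ≤ hi → ¬ P k d) →
  (∀ {k c} → lo < k → k ≤ hi → P k c → c ≤ d) →
  Reaches D₀ (P +[ hi , d ]) → Reaches D₀ (P +[ lo , d ])
slide P d {lo} {hi} 1≤lo lo≤hi free right R with m≤n⇒m<n∨m≡n lo≤hi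
... | inj₂ refl = R
... | inj₁ (s≤s {n = j} lo≤j) =
  slide P d 1≤lo lo≤j (λ lo≤k k≤j → free lo≤k (m≤n⇒m≤1+n k≤j))
    (λ lo<k k≤j → right lo<k (m≤n⇒m≤1+n k≤j))
    (slide-step P d j (≤-trans 1≤lo lo≤j) (free (m≤n⇒m≤1+n lo≤j) ≤-refl) (free lo≤j (n≤1+n j))
      (right (s≤s lo≤j) ≤-refl) R)

lowered : (a b t c : ℕ) → ℕ
lowered a b t c with c ≤? t
... | yes _ = a
... | no _ = b

lowered-≤ : ∀ {a b t c} → c ≤ t → lowered a b t c ≡ a
lowered-≤ {t = t} {c} c≤t with c ≤? t
... | yes _ = refl
... | no c≰t = ⊥-elim (c≰t c≤t)

lowered-> : ∀ {a b t c} → t < c → lowered a b t c ≡ b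
lowered-> {t = t} {c} t<c with c ≤? t
... | yes c≤t = ⊥-elim (<⇒≱ t<c c≤t)
... | no _ = refl

lowered≤ : ∀ {a b t c} → b ≤ a → lowered a b t c ≤ a
lowered≤ {t = t} {c} b≤a with c ≤? t
... | yes _ = ≤-refl
... | no _ = b≤a

lowered-suc : ∀ {a b t c} → c ≢ suc t → lowered a b (suc t) c ≡ lowered a b t c
lowered-suc {t = t} {c} c≢1+t with ≤-<-connex c t
... | inj₁ c≤t = trans (lowered-≤ (m≤n⇒m≤1+n c≤t)) (sym (lowered-≤ c≤t))
... | inj₂ t<c = trans (lowered-> (≤∧≢⇒< t<c (c≢1+t ∘ sym))) (sym (lowered-> t<c))

Swept : (ℕ → Set) → CellPred → (ℕ → ℕ) → CellPred
Swept Src Other row k c = Other k c ⊎ (Src c × k ≡ row c)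

module _ (Src : ℕ → Set) (Other : CellPred) where

  Swept-resp : ∀ {f g} → (∀ {c} → Src c → f c ≡ g c) →
    ∀ {k c} → Swept Src Other f k c ⇔ Swept Src Other g k c
  Swept-resp f≗g = mk⇔ (λ { (inj₁ o) → inj₁ o ; (inj₂ (s , e)) → inj₂ (s , trans e (f≗g s)) })
                       (λ { (inj₁ o) → inj₁ o ; (inj₂ (s , e)) → inj₂ (s , trans e (sym (f≗g s))) })

  Swept-split : ∀ {f g d j} → Src d → f d ≡ j → (∀ {c} → c ≢ d → f c ≡ g c) →
    ∀ {k c} → Swept Src Other f k c ⇔ (Swept (λ c → Src c × c ≢ d) Other g +[ j , d ]) k c
  Swept-split {f} {g} {d} {j} src fd off = mk⇔ to from
    where
    to : ∀ {k c} → Swept Src Other f k c → (Swept (λ c → Src c × c ≢ d) Other g +[ j , d ]) k c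
    to (inj₁ o) = inj₁ (inj₁ o)
    to {k} {c} (inj₂ (s , e)) with c ≟ d
    ... | yes refl = inj₂ (cong (_, d) (trans e fd))
    ... | no c≢d = inj₁ (inj₂ ((s , c≢d) , trans e (off c≢d)))
    from : ∀ {k c} → (Swept (λ c → Src c × c ≢ d) Other g +[ j , d ]) k c → Swept Src Other f k c
    from (inj₁ (inj₁ o)) = inj₁ o
    from (inj₁ (inj₂ ((s , c≢d) , e))) = inj₂ (s , trans e (sym (off c≢d)))
    from (inj₂ refl) = inj₂ (src , sym fd)

module _ {D₀ : Diagram} {Src : ℕ → Set} (Src? : Decidable Src) {Other : CellPred} {a b t₀ : ℕ}
  (1≤b : 1 ≤ b) (b≤a : b ≤ a)
  (bottom-free : ∀ {d} → t₀ < d → ¬ Other b d)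
  (band-free : ∀ {k c} → b < k → k ≤ a → ¬ Other k c) where

  sweep-step : ∀ {t} → t₀ ≤ t →
    Reaches D₀ (Swept Src Other (lowered a b (suc t))) → Reaches D₀ (Swept Src Other (lowered a b t))
  sweep-step {t} t₀≤t R with Src? (suc t)
  ... | no ¬src =
    Reaches-resp (Swept-resp Src Other {lowered a b (suc t)} λ src → lowered-suc {a} {b} λ { refl → ¬src src }) R
  ... | yes src =
    Reaches-resp (⇔-sym (Swept-split Src Other {lowered a b t} src (lowered-> {a} ≤-refl) λ _ → refl))
      (slide Rest (suc t) 1≤b b≤a free right
        (Reaches-resp (Swept-split Src Other {lowered a b (suc t)} src (lowered-≤ {b = b} ≤-refl) lowered-suc) R))
    where
    Rest : CellPred
    Rest = Swept (λ c → Src c × c ≢ suc t) Other (lowered a b t)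
    free : ∀ {k} → b ≤ k → k ≤ a → ¬ Rest k (suc t)
    free b≤k k≤a (inj₂ ((_ , d≢d) , _)) = d≢d refl
    free b≤k k≤a (inj₁ o) with m≤n⇒m<n∨m≡n b≤k
    ... | inj₁ b<k = band-free b<k k≤a o
    ... | inj₂ refl = bottom-free (s≤s t₀≤t) o
    right : ∀ {k c} → b < k → k ≤ a → Rest k c → c ≤ suc t
    right b<k k≤a (inj₁ o) = ⊥-elim (band-free b<k k≤a o)
    right {c = c} b<k k≤a (inj₂ (_ , refl)) with c ≤? t
    ... | yes c≤t = m≤n⇒m≤1+n c≤t
    ... | no _ = ⊥-elim (<-irrefl refl b<k)

  sweep : ∀ {t N} → t₀ ≤ t → t ≤ N →
    Reaches D₀ (Swept Src Other (lowered a b N)) → Reaches D₀ (Swept Src Other (lowered a b t))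
  sweep {t} {N} t₀≤t t≤N R = go (N ∸ t) t₀≤t (subst Stage (sym (m∸n+n≡m t≤N)) R)
    where
    Stage : ℕ → Set
    Stage = Reaches D₀ ∘ Swept Src Other ∘ lowered a b
    go : ∀ n {t} → t₀ ≤ t → Stage (n + t) → Stage t
    go zero t₀≤t R = R
    go (suc n) {t} t₀≤t R = sweep-step t₀≤t (go n (m≤n⇒m≤1+n t₀≤t) (subst Stage (sym (+-suc n t)) R))

-- Column profiles

moved-off-column : ∀ {D r r' c k x} → x ≢ c → (k , x) ∈ (r' , c) ∷ removeCell (r , c) D ⇔ (k , x) ∈ D
moved-off-column {D} {r} {r'} {c} {k} {x} x≢c =
  mk⇔ to (λ m → there (∈-removeCell⁺ m (x≢c ∘ cong proj₂)))
  where
  to : (k , x) ∈ (r' , c) ∷ removeCell (r , c) D → (k , x) ∈ D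
  to (here refl) = ⊥-elim (x≢c refl)
  to (there m) = proj₁ (∈-removeCell⁻ m)

moved-column : ∀ {D r r' c k} →
  (k , c) ∈ (r' , c) ∷ removeCell (r , c) D ⇔ (k ≡ r' ⊎ ((k , c) ∈ D × k ≢ r))
moved-column {D} {r} {r'} {c} {k} = mk⇔ to from
  where
  to : (k , c) ∈ (r' , c) ∷ removeCell (r , c) D → k ≡ r' ⊎ ((k , c) ∈ D × k ≢ r)
  to (here refl) = inj₁ refl
  to (there m) with ∈-removeCell⁻ m
  ... | m' , moved = inj₂ (m' , moved ∘ cong (_, _))
  from : k ≡ r' ⊎ ((k , c) ∈ D × k ≢ r) → (k , c) ∈ (r' , c) ∷ removeCell (r , c) D
  from (inj₁ refl) = here refl
  from (inj₂ (m , k≢r)) = there (∈-removeCell⁺ m (k≢r ∘ cong proj₁))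

infix 4 _[_]≔_

_[_]≔_ : (ℕ → ℕ) → ℕ → ℕ → ℕ → ℕ
(f [ c ]≔ v) x with x ≟ c
... | yes _ = v
... | no _ = f x

[]≔-other : ∀ f {c x} v → x ≢ c → (f [ c ]≔ v) x ≡ f x
[]≔-other f {c} {x} v x≢c with x ≟ c
... | yes x≡c = ⊥-elim (x≢c x≡c)
... | no _ = refl

[]≔-≤ : ∀ f {c v} → v ≤ f c → ∀ x → (f [ c ]≔ v) x ≤ f x
[]≔-≤ f {c} v≤ x with x ≟ c
... | yes refl = v≤
... | no _ = ≤-refl

either-⊓⊔ : ∀ {k x y} → (k ≡ x ⊎ k ≡ y) ⇔ (k ≡ x ⊓ y ⊎ k ≡ x ⊔ y)
either-⊓⊔ {k} {x} {y} with ≤-total x y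
... | inj₁ x≤y rewrite m≤n⇒m⊓n≡m x≤y | m≤n⇒m⊔n≡n x≤y = mk⇔ (λ e → e) (λ e → e)
... | inj₂ y≤x rewrite m≥n⇒m⊓n≡n y≤x | m≥n⇒m⊔n≡m y≤x = mk⇔ swap swap

⊓<⊔ : ∀ {x y} → x ≢ y → x ⊓ y < x ⊔ y
⊓<⊔ {x} {y} x≢y with <-cmp x y
... | tri< x<y _ _ rewrite m≤n⇒m⊓n≡m (<⇒≤ x<y) | m≤n⇒m⊔n≡n (<⇒≤ x<y) = x<y
... | tri≈ _ x≡y _ = ⊥-elim (x≢y x≡y)
... | tri> _ _ y<x rewrite m≥n⇒m⊓n≡n (<⇒≤ y<x) | m≥n⇒m⊔n≡m (<⇒≤ y<x) = y<x

module ColumnProfile (Occ Two : ℕ → Set) (Two⇒Occ : ∀ {c} → Two c → Occ c) (Two? : Decidable Two) where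

  ProfileCells : (lo hi : ℕ → ℕ) → CellPred
  ProfileCells lo hi k c = Occ c × (k ≡ lo c ⊎ k ≡ hi c)

  record Profile (D : Diagram) (lo hi : ℕ → ℕ) : Set where
    field
      realises : Realises D (ProfileCells lo hi)
      positive : ∀ {c} → Occ c → 1 ≤ lo c
      lo<hi : ∀ {c} → Two c → lo c < hi c
      lo≡hi : ∀ {c} → Occ c → ¬ Two c → lo c ≡ hi c

    lo∈ : ∀ {c} → Occ c → (lo c , c) ∈ D
    lo∈ occ = Equivalence.from realises (occ , inj₁ refl)

    hi∈ : ∀ {c} → Occ c → (hi c , c) ∈ D
    hi∈ occ = Equivalence.from realises (occ , inj₂ refl)

    ∈⇒occ : ∀ {k c} → (k , c) ∈ D → Occ c
    ∈⇒occ = proj₁ ∘ Equivalence.to realises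

    ∈⇒lo∨hi : ∀ {k c} → (k , c) ∈ D → k ≡ lo c ⊎ k ≡ hi c
    ∈⇒lo∨hi = proj₂ ∘ Equivalence.to realises

    lo≤hi : ∀ {c} → Occ c → lo c ≤ hi c
    lo≤hi {c} occ with Two? c
    ... | yes two = <⇒≤ (lo<hi two)
    ... | no one = ≤-reflexive (lo≡hi occ one)

    lo≤∈ : ∀ {k c} → (k , c) ∈ D → lo c ≤ k
    lo≤∈ m with ∈⇒lo∨hi m
    ... | inj₁ refl = ≤-refl
    ... | inj₂ refl = lo≤hi (∈⇒occ m)

    ∈≤hi : ∀ {k c} → (k , c) ∈ D → k ≤ hi c
    ∈≤hi m with ∈⇒lo∨hi m
    ... | inj₁ refl = lo≤hi (∈⇒occ m)
    ... | inj₂ refl = ≤-refl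

    ∈⇒≡lo : ∀ {k c} → (k , c) ∈ D → ¬ Two c → k ≡ lo c
    ∈⇒≡lo m one with ∈⇒lo∨hi m
    ... | inj₁ e = e
    ... | inj₂ e = trans e (sym (lo≡hi (∈⇒occ m) one))

  open Profile

  Profile-≈ : ∀ {D E lo hi} → D ≈ E → Profile D lo hi → Profile E lo hi
  Profile-≈ D≈E P = record
    { realises = mk⇔ (Equivalence.to (realises P) ∘ ≈⇒⊆ (≈-sym D≈E))
                     (≈⇒⊆ D≈E ∘ Equivalence.from (realises P))
    ; positive = positive P ; lo<hi = lo<hi P ; lo≡hi = lo≡hi P }

  Profile-unique : ∀ {D lo hi lo' hi'} → Profile D lo hi → Profile D lo' hi' →
    ∀ {c} → Occ c → lo c ≡ lo' c × hi c ≡ hi' c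
  Profile-unique P P' occ =
    ≤-antisym (lo≤∈ P (lo∈ P' occ)) (lo≤∈ P' (lo∈ P occ)) ,
    ≤-antisym (∈≤hi P' (hi∈ P occ)) (∈≤hi P (hi∈ P' occ))

  Profile⇒≈ : ∀ {D E lo hi lo' hi'} → Profile D lo hi → Profile E lo' hi' →
    (∀ {c} → Occ c → lo c ≡ lo' c × hi c ≡ hi' c) → D ≈ E
  Profile⇒≈ {D} {E} {lo} {hi} {lo'} {hi'} P P' agree (k , c) =
    mk⇔ (Equivalence.from (realises P') ∘ transport ∘ Equivalence.to (realises P))
        (Equivalence.from (realises P) ∘ transport⁻ ∘ Equivalence.to (realises P'))
    where
    transport : ProfileCells lo hi k c → ProfileCells lo' hi' k c
    transport (occ , inj₁ e) = occ , inj₁ (trans e (proj₁ (agree occ)))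
    transport (occ , inj₂ e) = occ , inj₂ (trans e (proj₂ (agree occ)))
    transport⁻ : ProfileCells lo' hi' k c → ProfileCells lo hi k c
    transport⁻ (occ , inj₁ e) = occ , inj₁ (trans e (sym (proj₁ (agree occ))))
    transport⁻ (occ , inj₂ e) = occ , inj₂ (trans e (sym (proj₂ (agree occ))))

  record Lowering (lo hi lo' hi' : ℕ → ℕ) : Set where
    field
      lo-mono : ∀ c → lo' c ≤ lo c
      hi-mono : ∀ c → hi' c ≤ hi c
      keeps-below : ∀ {a b} → Occ a → ¬ Two a → Two b → a < b → hi b ≤ lo a → hi' b ≤ lo' a

  open Lowering

  Lowering-refl : ∀ {lo hi} → Lowering lo hi lo hi
  Lowering-refl = record
    { lo-mono = λ _ → ≤-refl ; hi-mono = λ _ → ≤-refl ; keeps-below = λ _ _ _ _ below → below }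

  Lowering-trans : ∀ {lo hi lo' hi' lo'' hi''} → Lowering lo hi lo' hi' → Lowering lo' hi' lo'' hi'' →
    Lowering lo hi lo'' hi''
  Lowering-trans L L' = record
    { lo-mono = λ c → ≤-trans (lo-mono L' c) (lo-mono L c)
    ; hi-mono = λ c → ≤-trans (hi-mono L' c) (hi-mono L c)
    ; keeps-below = λ occ one two a<b → keeps-below L' occ one two a<b ∘ keeps-below L occ one two a<b }

  Profile-update : ∀ {D E lo hi c nl nh} → Profile D lo hi → Occ c →
    (∀ {k x} → x ≢ c → (k , x) ∈ E ⇔ (k , x) ∈ D) →
    (∀ {k} → (k , c) ∈ E ⇔ (k ≡ nl ⊎ k ≡ nh)) →
    1 ≤ nl → (Two c → nl < nh) → (¬ Two c → nl ≡ nh) →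
    Profile E (lo [ c ]≔ nl) (hi [ c ]≔ nh)
  Profile-update {D} {E} {lo} {hi} {c} {nl} {nh} P occ off on 1≤nl two one = record
    { realises = λ {k} {x} → realises' k x ; positive = positive' ; lo<hi = lo<hi' ; lo≡hi = lo≡hi' }
    where
    realises' : ∀ k x → (k , x) ∈ E ⇔ ProfileCells (lo [ c ]≔ nl) (hi [ c ]≔ nh) k x
    realises' k x with x ≟ c
    ... | yes refl = mk⇔ (λ m → occ , Equivalence.to on m) (Equivalence.from on ∘ proj₂)
    ... | no x≢c = realises P ⇔-∘ off x≢c
    positive' : ∀ {x} → Occ x → 1 ≤ (lo [ c ]≔ nl) x
    positive' {x} occx with x ≟ c
    ... | yes refl = 1≤nl
    ... | no _ = positive P occx
    lo<hi' : ∀ {x} → Two x → (lo [ c ]≔ nl) x < (hi [ c ]≔ nh) x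
    lo<hi' {x} twox with x ≟ c
    ... | yes refl = two twox
    ... | no _ = lo<hi P twox
    lo≡hi' : ∀ {x} → Occ x → ¬ Two x → (lo [ c ]≔ nl) x ≡ (hi [ c ]≔ nh) x
    lo≡hi' {x} occx onex with x ≟ c
    ... | yes refl = one onex
    ... | no _ = lo≡hi P occx onex

  other-cell : ∀ {D lo hi r c} → Profile D lo hi → Two c → (r , c) ∈ D →
    ∃[ o ] ((o , c) ∈ D × (o ≡ lo c ⊎ r ≡ lo c) × (∀ {k} → ((k , c) ∈ D × k ≢ r) ⇔ k ≡ o))
  other-cell {lo = lo} {hi} {r} {c} P two m with ∈⇒lo∨hi P m
  ... | inj₁ refl = hi c , hi∈ P (Two⇒Occ two) , inj₂ refl ,
    mk⇔ (λ { (m' , k≢lo) → [ (λ k≡lo → ⊥-elim (k≢lo k≡lo)) , (λ e → e) ]′ (∈⇒lo∨hi P m') })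
        (λ { refl → hi∈ P (Two⇒Occ two) , >⇒≢ (lo<hi P two) })
  ... | inj₂ refl = lo c , lo∈ P (Two⇒Occ two) , inj₁ refl ,
    mk⇔ (λ { (m' , k≢hi) → [ (λ e → e) , (λ k≡hi → ⊥-elim (k≢hi k≡hi)) ]′ (∈⇒lo∨hi P m') })
        (λ { refl → lo∈ P (Two⇒Occ two) , <⇒≢ (lo<hi P two) })

  record LowerProfile (E : Diagram) (lo hi : ℕ → ℕ) : Set where
    field
      lo′ hi′ : ℕ → ℕ
      profile : Profile E lo′ hi′
      lowering : Lowering lo hi lo′ hi′

  Profile-move-single : ∀ {D lo hi r c r'} → Profile D lo hi → ¬ Two c → RowMax D r c → TopGap D c r r' →
    LowerProfile ((r' , c) ∷ removeCell (r , c) D) lo hi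
  Profile-move-single {D} {lo} {hi} {r} {c} {r'} P one m g = record
    { lo′ = lo [ c ]≔ r' ; hi′ = hi [ c ]≔ r'
    ; profile = Profile-update P occ moved-off-column column (TopGap.positive g) (⊥-elim ∘ one) (λ _ → refl)
    ; lowering = record
      { lo-mono = []≔-≤ lo r'≤lo
      ; hi-mono = []≔-≤ hi (subst (r' ≤_) (lo≡hi P occ one) r'≤lo)
      ; keeps-below = keeps-below' } }
    where
    occ : Occ c
    occ = ∈⇒occ P (RowMax.cell m)
    r≡lo : r ≡ lo c
    r≡lo = ∈⇒≡lo P (RowMax.cell m) one
    r'≤lo : r' ≤ lo c
    r'≤lo = subst (r' ≤_) r≡lo (<⇒≤ (TopGap.below g))
    column : ∀ {k} → (k , c) ∈ (r' , c) ∷ removeCell (r , c) D ⇔ (k ≡ r' ⊎ k ≡ r')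
    column = mk⇔ ([ inj₁ , (λ { (m' , k≢r) → ⊥-elim (k≢r (trans (∈⇒≡lo P m' one) (sym r≡lo))) }) ]′
                    ∘ Equivalence.to moved-column)
                 (Equivalence.from (moved-column {D} {r}) ∘ [ inj₁ , inj₁ ]′)
    -- hi b < r as c is rightmost in row r, and r' < hi b would put a second cell in column c
    keeps-below' : ∀ {a b} → Occ a → ¬ Two a → Two b → a < b → hi b ≤ lo a →
      (hi [ c ]≔ r') b ≤ (lo [ c ]≔ r') a
    keeps-below' {a} {b} _ _ twob a<b below with a ≟ c
    ... | no _ = ≤-trans ([]≔-≤ hi (subst (r' ≤_) (lo≡hi P occ one) r'≤lo) b) below
    ... | yes refl rewrite []≔-other hi r' (λ b≡a → one (subst Two b≡a twob)) = ≮⇒≥ λ r'<hib →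
      <-irrefl (trans (∈⇒≡lo P (TopGap.filled g r'<hib hib<r) one) (sym r≡lo)) hib<r
      where
      hib∈ : (hi b , b) ∈ D
      hib∈ = hi∈ P (Two⇒Occ twob)
      hib<r : hi b < r
      hib<r = ≤∧≢⇒< (subst (hi b ≤_) (sym r≡lo) below)
                    (λ { refl → <⇒≱ a<b (RowMax.rightmost m hib∈) })
  Profile-move-two : ∀ {D lo hi r c r'} → Profile D lo hi → Two c → RowMax D r c → TopGap D c r r' →
    LowerProfile ((r' , c) ∷ removeCell (r , c) D) lo hi
  Profile-move-two {D} {lo} {hi} {r} {c} {r'} P two m g with other-cell P two (RowMax.cell m)
  ... | o , o∈ , o≡lo∨r≡lo , remaining = record
    { lo′ = lo [ c ]≔ r' ⊓ o ; hi′ = hi [ c ]≔ r' ⊔ o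
    ; profile = Profile-update P (Two⇒Occ two) moved-off-column column
                  (⊓-glb (TopGap.positive g) (≤-trans (positive P (Two⇒Occ two)) (lo≤∈ P o∈)))
                  (λ _ → ⊓<⊔ λ { refl → TopGap.free g o∈ }) (λ one → ⊥-elim (one two))
    ; lowering = record
      { lo-mono = []≔-≤ lo lo-bound
      ; hi-mono = []≔-≤ hi hi-bound
      ; keeps-below = keeps-below' } }
    where
    column : ∀ {k} → (k , c) ∈ (r' , c) ∷ removeCell (r , c) D ⇔ (k ≡ r' ⊓ o ⊎ k ≡ r' ⊔ o)
    column = either-⊓⊔ ⇔-∘ (mk⇔ (map₂ (Equivalence.to remaining)) (map₂ (Equivalence.from remaining))
                        ⇔-∘ moved-column)
    hi-bound : r' ⊔ o ≤ hi c
    hi-bound = ⊔-lub (<⇒≤ (<-≤-trans (TopGap.below g) (∈≤hi P (RowMax.cell m)))) (∈≤hi P o∈)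
    lo-bound : r' ⊓ o ≤ lo c
    lo-bound = [ (λ { refl → m⊓n≤n r' o }) , (λ { refl → ≤-trans (m⊓n≤m r' o) (<⇒≤ (TopGap.below g)) }) ]′
                 o≡lo∨r≡lo
    keeps-below' : ∀ {a b} → Occ a → ¬ Two a → Two b → a < b → hi b ≤ lo a →
      (hi [ c ]≔ r' ⊔ o) b ≤ (lo [ c ]≔ r' ⊓ o) a
    keeps-below' {a} {b} _ onea _ _ below with a ≟ c
    ... | yes refl = ⊥-elim (onea two)
    ... | no _ = ≤-trans ([]≔-≤ hi hi-bound b) below

  Profile-move : ∀ {D lo hi r c r'} → Profile D lo hi → RowMax D r c → TopGap D c r r' →
    LowerProfile ((r' , c) ∷ removeCell (r , c) D) lo hi
  Profile-move {c = c} P m g with Two? c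
  ... | yes two = Profile-move-two P two m g
  ... | no one = Profile-move-single P one m g

  open LowerProfile

  Profile-kohnertMove : ∀ {D lo hi} → Profile D lo hi → ∀ r → LowerProfile (kohnertMove r D) lo hi
  Profile-kohnertMove {D} P r with kohnertMove r D | move r D
  ... | _ | blocked _ = record { profile = P ; lowering = Lowering-refl }
  ... | _ | moves m g = Profile-move P m g

  Profile-applyMoves : ∀ {D lo hi} → Profile D lo hi → ∀ rs → LowerProfile (applyMoves rs D) lo hi
  Profile-applyMoves P [] = record { profile = P ; lowering = Lowering-refl }
  Profile-applyMoves {D} {lo} {hi} P (r ∷ rs) = record
    { profile = profile rest ; lowering = Lowering-trans (lowering first) (lowering rest) }
    where
    first : LowerProfile (kohnertMove r D) lo hi
    first = Profile-kohnertMove P r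
    rest : LowerProfile (applyMoves rs (kohnertMove r D)) (lo′ first) (hi′ first)
    rest = Profile-applyMoves (profile first) rs

  no-three-rows : ∀ {D lo hi x y z c} → Profile D lo hi →
    (x , c) ∈ D → (y , c) ∈ D → (z , c) ∈ D → x < y → y < z → ⊥
  no-three-rows P x∈ y∈ z∈ x<y y<z with ∈⇒lo∨hi P y∈
  ... | inj₁ refl = <⇒≱ x<y (lo≤∈ P x∈)
  ... | inj₂ refl = <⇒≱ y<z (∈≤hi P z∈)

  module _ {D lo hi} (P : Profile D lo hi) (stuck : Stuck D) where

    Stuck⇒hi≤2 : ∀ {c} → Occ c → hi c ≤ 2
    Stuck⇒hi≤2 {c} occ with stuck (hi c) (hi∈ P occ)
    ... | c* , rowMax , filled = ≮⇒≥ λ 2<hi →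
      no-three-rows P (filled ≤-refl (<-trans (s≤s (s≤s z≤n)) 2<hi)) (filled (s≤s z≤n) 2<hi)
        (RowMax.cell rowMax) (s≤s (s≤s z≤n)) 2<hi

    Stuck⇒Two-rows : ∀ {c} → Two c → lo c ≡ 1 × hi c ≡ 2
    Stuck⇒Two-rows two = ≤-antisym (≤-pred (≤-trans (lo<hi P two) (Stuck⇒hi≤2 occ))) (positive P occ) ,
                         ≤-antisym (Stuck⇒hi≤2 occ) (≤-trans (s≤s (positive P occ)) (lo<hi P two))
      where
      occ : Occ _
      occ = Two⇒Occ two

    Stuck⇒row2 : ∀ {c} → (2 , c) ∈ D → ∃[ c* ] (c ≤ c* × Two c*)
    Stuck⇒row2 m with stuck 2 m
    ... | c* , rowMax , filled with Two? c*
    ...   | yes two = c* , RowMax.rightmost rowMax m , two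
    ...   | no one
      with trans (∈⇒≡lo P (filled ≤-refl ≤-refl) one) (sym (∈⇒≡lo P (RowMax.cell rowMax) one))
    ...     | ()

  Profile-⪯ : ∀ {D E lo hi} → Profile D lo hi → E ⪯ D → LowerProfile E lo hi
  Profile-⪯ {D} {lo = lo} {hi} P (rs , E≈) =
    record { profile = Profile-≈ (≈-sym E≈) (profile L) ; lowering = lowering L }
    where
    L : LowerProfile (applyMoves rs D) lo hi
    L = Profile-applyMoves P rs

  Profile-antisym : ∀ {D D' lo hi} → Profile D lo hi → D' ⪯ D → D ⪯ D' → D' ≈ D
  Profile-antisym {D} {D'} {lo} {hi} P D'⪯D D⪯D' = Profile⇒≈ (profile L₁) P agree
    where
    L₁ : LowerProfile D' lo hi
    L₁ = Profile-⪯ P D'⪯D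
    L₂ : LowerProfile D (lo′ L₁) (hi′ L₁)
    L₂ = Profile-⪯ (profile L₁) D⪯D'
    agree : ∀ {c} → Occ c → lo′ L₁ c ≡ lo c × hi′ L₁ c ≡ hi c
    agree {c} occ with Profile-unique P (profile L₂) occ
    ... | lo≡ , hi≡ =
      ≤-antisym (lo-mono (lowering L₁) c) (≤-trans (≤-reflexive lo≡) (lo-mono (lowering L₂) c)) ,
      ≤-antisym (hi-mono (lowering L₁) c) (≤-trans (≤-reflexive hi≡) (hi-mono (lowering L₂) c))

-- Two-row diagrams

module TwoRow (D₀ : Diagram) (r₁ r₂ : ℕ) (two-row : TwoRowDiagram D₀ r₁ r₂) where

  InA InB Occ Two : ℕ → Set
  InA c = (r₁ , c) ∈ D₀
  InB c = (r₂ , c) ∈ D₀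
  Occ c = InA c ⊎ InB c
  Two c = InA c × InB c

  InA? : Decidable InA
  InA? c = (r₁ , c) ∈?ᶜ D₀

  InB? : Decidable InB
  InB? c = (r₂ , c) ∈?ᶜ D₀

  open ColumnProfile Occ Two (inj₁ ∘ proj₁) (λ c → InA? c ×-dec InB? c)
  open Profile
  open Lowering
  open LowerProfile

  positive-cells : ∀ {k c} → (k , c) ∈ D₀ → 1 ≤ k × 1 ≤ c
  positive-cells = proj₁ two-row _ _

  rows : ∀ {k c} → (k , c) ∈ D₀ → k ≡ r₁ ⊎ k ≡ r₂
  rows = proj₁ (proj₂ two-row) _ _

  r₁<r₂ : r₁ < r₂
  r₁<r₂ = proj₂ (proj₂ (proj₂ (proj₂ two-row)))

  row≤r₂ : ∀ {k c} → (k , c) ∈ D₀ → k ≤ r₂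
  row≤r₂ m = [ (λ { refl → <⇒≤ r₁<r₂ }) , (λ { refl → ≤-refl }) ]′ (rows m)

  1≤r₁ : 1 ≤ r₁
  1≤r₁ = proj₁ (positive-cells (proj₂ (proj₁ (proj₂ (proj₂ two-row)))))

  lo₀ hi₀ : ℕ → ℕ
  lo₀ c with InA? c
  ... | yes _ = r₁
  ... | no _ = r₂
  hi₀ c with InB? c
  ... | yes _ = r₂
  ... | no _ = r₁

  Profile₀ : Profile D₀ lo₀ hi₀
  Profile₀ = record { realises = realises₀ ; positive = positive₀ ; lo<hi = lo<hi₀ ; lo≡hi = lo≡hi₀ }
    where
    realises₀ : ∀ {k c} → (k , c) ∈ D₀ ⇔ (Occ c × (k ≡ lo₀ c ⊎ k ≡ hi₀ c))
    realises₀ {k} {c} with InA? c | InB? c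
    ... | yes a | yes b = mk⇔ (λ m → inj₁ a , rows m) λ { (_ , inj₁ refl) → a ; (_ , inj₂ refl) → b }
    ... | yes a | no ¬b =
      mk⇔ (λ m → inj₁ a , inj₁ (onlyA m)) λ { (_ , inj₁ refl) → a ; (_ , inj₂ refl) → a }
      where
      onlyA : (k , c) ∈ D₀ → k ≡ r₁
      onlyA m = [ (λ e → e) , (λ { refl → ⊥-elim (¬b m) }) ]′ (rows m)
    ... | no ¬a | yes b =
      mk⇔ (λ m → inj₂ b , inj₁ (onlyB m)) λ { (_ , inj₁ refl) → b ; (_ , inj₂ refl) → b }
      where
      onlyB : (k , c) ∈ D₀ → k ≡ r₂
      onlyB m = [ (λ { refl → ⊥-elim (¬a m) }) , (λ e → e) ]′ (rows m)
    ... | no ¬a | no ¬b = mk⇔ (λ m → ⊥-elim ([ (λ { refl → ¬a m }) , (λ { refl → ¬b m }) ]′ (rows m)))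
                               (λ { (occ , _) → ⊥-elim ([ ¬a , ¬b ]′ occ) })
    positive₀ : ∀ {c} → Occ c → 1 ≤ lo₀ c
    positive₀ {c} _ with InA? c
    ... | yes _ = 1≤r₁
    ... | no _ = ≤-trans 1≤r₁ (<⇒≤ r₁<r₂)
    lo<hi₀ : ∀ {c} → Two c → lo₀ c < hi₀ c
    lo<hi₀ {c} (a , b) with InA? c | InB? c
    ... | yes _ | yes _ = r₁<r₂
    ... | no ¬a | _ = ⊥-elim (¬a a)
    ... | yes _ | no ¬b = ⊥-elim (¬b b)
    lo≡hi₀ : ∀ {c} → Occ c → ¬ Two c → lo₀ c ≡ hi₀ c
    lo≡hi₀ {c} occ one with InA? c | InB? c
    ... | yes a | yes b = ⊥-elim (one (a , b))
    ... | yes _ | no _ = refl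
    ... | no _ | yes _ = refl
    ... | no ¬a | no ¬b = ⊥-elim ([ ¬a , ¬b ]′ occ)

  Condition : Set
  Condition = r₁ ≡ 1 ⊎ (r₁ > 1 × ColLeftEmpty D₀ r₁ r₂)

  one-or-two : ∀ {x} → 1 ≤ x → x ≤ 2 → x ≡ 1 ⊎ x ≡ 2
  one-or-two {suc zero} _ _ = inj₁ refl
  one-or-two {suc (suc zero)} _ _ = inj₂ refl
  one-or-two {suc (suc (suc _))} _ (s≤s (s≤s ()))

  left-of-Two : ∀ {c c*} → ¬ Two c → Two c* → c ≤ c* → c < c*
  left-of-Two one two c≤c* = ≤∧≢⇒< c≤c* λ { refl → one two }

  module StuckBelow {E} (L : LowerProfile E lo₀ hi₀) (stuck : Stuck E) where

    lo-one-or-two : ∀ {c} → Occ c → lo′ L c ≡ 1 ⊎ lo′ L c ≡ 2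
    lo-one-or-two occ = one-or-two (positive (profile L) occ)
                                   (≤-trans (lo≤hi (profile L) occ) (Stuck⇒hi≤2 (profile L) stuck occ))

    raised⇒Two-right : ∀ {c} → Occ c → lo′ L c ≡ 2 → ∃[ c* ] (c ≤ c* × Two c*)
    raised⇒Two-right occ lo≡2 =
      Stuck⇒row2 (profile L) stuck (subst (λ k → (k , _) ∈ E) lo≡2 (lo∈ (profile L) occ))

    A-only-bottom : Condition → ∀ {c} → InA c → ¬ InB c → lo′ L c ≡ 1
    A-only-bottom cond {c} a ¬b with lo-one-or-two (inj₁ a)
    ... | inj₁ lo≡1 = lo≡1
    ... | inj₂ lo≡2 with raised⇒Two-right (inj₁ a) lo≡2 | cond
    ...   | _ | inj₁ r₁≡1 = ⊥-elim (1+n≰n (subst (_≤ 1) lo≡2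
              (≤-trans (lo-mono (lowering L) c) (≤-trans (lo≤∈ Profile₀ a) (≤-reflexive r₁≡1)))))
    ...   | c* , c≤c* , two | inj₂ (_ , no-left) =
              ⊥-elim (no-left c ((a , ¬b) , c* , two , left-of-Two (¬b ∘ proj₂) two c≤c*))

    -- the Two column c* to the right of c started weakly below c, and stays so
    B-only-raised : ∀ {c} → InB c → ¬ InA c → lo′ L c ≡ 2 →
      ∀ {E'} (L' : LowerProfile E' lo₀ hi₀) → Stuck E' → lo′ L' c ≡ 2
    B-only-raised {c} b ¬a lo≡2 L' stuck' with raised⇒Two-right (inj₂ b) lo≡2
    ... | c* , c≤c* , two = ≤-antisym
      (≤-trans (lo≤hi (profile L') (inj₂ b)) (Stuck⇒hi≤2 (profile L') stuck' (inj₂ b)))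
      (subst (_≤ lo′ L' c) (proj₂ (Stuck⇒Two-rows (profile L') stuck' two))
        (keeps-below (lowering L') (inj₂ b) one two (left-of-Two one two c≤c*) below₀))
      where
      one : ¬ Two c
      one = ¬a ∘ proj₁
      below₀ : hi₀ c* ≤ lo₀ c
      below₀ = subst (hi₀ c* ≤_) (∈⇒≡lo Profile₀ b one)
                 (row≤r₂ (hi∈ Profile₀ (inj₁ (proj₁ two))))

  stuck-unique : Condition → ∀ {E E'} → LowerProfile E lo₀ hi₀ → Stuck E →
    LowerProfile E' lo₀ hi₀ → Stuck E' → E ≈ E'
  stuck-unique cond {E} {E'} L stuck L' stuck' = Profile⇒≈ (profile L) (profile L') agree
    where
    module B = StuckBelow L stuck
    module B' = StuckBelow L' stuck'
    single-agree : ∀ {c} → Occ c → ¬ Two c → lo′ L c ≡ lo′ L' c →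
      lo′ L c ≡ lo′ L' c × hi′ L c ≡ hi′ L' c
    single-agree occ one lo≡ =
      lo≡ , trans (sym (lo≡hi (profile L) occ one)) (trans lo≡ (lo≡hi (profile L') occ one))
    agree : ∀ {c} → Occ c → lo′ L c ≡ lo′ L' c × hi′ L c ≡ hi′ L' c
    agree {c} occ with InA? c | InB? c
    ... | yes a | yes b with Stuck⇒Two-rows (profile L) stuck (a , b) | Stuck⇒Two-rows (profile L') stuck' (a , b)
    ...   | lo≡1 , hi≡2 | lo'≡1 , hi'≡2 = trans lo≡1 (sym lo'≡1) , trans hi≡2 (sym hi'≡2)
    agree {c} occ | yes a | no ¬b =
      single-agree occ (¬b ∘ proj₂) (trans (B.A-only-bottom cond a ¬b) (sym (B'.A-only-bottom cond a ¬b)))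
    agree {c} occ | no ¬a | yes b = single-agree occ (¬a ∘ proj₁) lo-agree
      where
      lo-agree : lo′ L c ≡ lo′ L' c
      lo-agree with B.lo-one-or-two occ | B'.lo-one-or-two occ
      ... | inj₂ lo≡2 | _ = trans lo≡2 (sym (B.B-only-raised b ¬a lo≡2 L' stuck'))
      ... | _ | inj₂ lo'≡2 = trans (B'.B-only-raised b ¬a lo'≡2 L stuck) (sym lo'≡2)
      ... | inj₁ lo≡1 | inj₁ lo'≡1 = trans lo≡1 (sym lo'≡1)
    agree {c} occ | no ¬a | no ¬b = ⊥-elim ([ ¬a , ¬b ]′ occ)

  condition⇒bounded : Condition → Bounded D₀
  condition⇒bounded cond = (M , Stuck⇒IsMinimal (ss , ≈-refl) stuckM , unique-min) ,
                           (D₀ , maximal , unique-max)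
    where
    ss : List ℕ
    ss = proj₁ (reach-Stuck D₀)
    M : Diagram
    M = applyMoves ss D₀
    stuckM : Stuck M
    stuckM = proj₂ (reach-Stuck D₀)
    unique-min : ∀ m → IsMinimal D₀ m → m ≈ M
    unique-min m minimal = stuck-unique cond (Profile-⪯ Profile₀ (proj₁ minimal)) (IsMinimal⇒Stuck minimal)
                                             (Profile-⪯ Profile₀ (ss , ≈-refl)) stuckM
    maximal : IsMaximal D₀ D₀
    maximal = ([] , ≈-refl) , λ _ D⪯D₀ D₀⪯D → Profile-antisym Profile₀ D⪯D₀ D₀⪯D
    unique-max : ∀ M' → IsMaximal D₀ M' → M' ≈ D₀
    unique-max M' (M'⪯D₀ , maximal') = ≈-sym (maximal' D₀ ([] , ≈-refl) M'⪯D₀)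

  N : ℕ
  N = sumBy proj₂ D₀

  column≤N : ∀ {k c} → (k , c) ∈ D₀ → c ≤ N
  column≤N = ∈⇒≤sumBy proj₂

  B-cells : CellPred
  B-cells k c = InB c × k ≡ r₂

  A-lowered : ℕ → CellPred
  A-lowered t k c = InA c × k ≡ lowered r₁ 1 t c

  reach-A-lowered : ∀ {t} → t ≤ N → Reaches D₀ (Swept InA B-cells (lowered r₁ 1 t))
  reach-A-lowered t≤N = sweep InA? {Other = B-cells} ≤-refl 1≤r₁
    (λ { _ (_ , refl) → <⇒≱ r₁<r₂ 1≤r₁ }) (λ { _ k≤r₁ (_ , refl) → <⇒≱ r₁<r₂ k≤r₁ })
    ≤-refl t≤N ([] , realises₀)
    where
    realises₀ : Realises D₀ (Swept InA B-cells (lowered r₁ 1 N))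
    realises₀ {k} {c} = mk⇔ to from
      where
      to : (k , c) ∈ D₀ → Swept InA B-cells (lowered r₁ 1 N) k c
      to m = [ (λ { refl → inj₂ (m , sym (lowered-≤ (column≤N m))) }) , (λ { refl → inj₁ (m , refl) }) ]′
               (rows m)
      from : Swept InA B-cells (lowered r₁ 1 N) k c → (k , c) ∈ D₀
      from (inj₁ (b , refl)) = b
      from (inj₂ (a , refl)) = subst (λ k → (k , c) ∈ D₀) (sym (lowered-≤ (column≤N a))) a

  reach-AB-lowered : 1 < r₁ → ∀ {T} → T ≤ N → Reaches D₀ (Swept InB (A-lowered T) (lowered r₂ r₁ T))
  reach-AB-lowered 1<r₁ {T} T≤N = sweep InB? {Other = A-lowered T} 1≤r₁ (<⇒≤ r₁<r₂)
    (λ { T<d (_ , e) → <⇒≢ 1<r₁ (sym (trans e (lowered-> T<d))) })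
    (λ { r₁<k _ (_ , refl) → <⇒≱ r₁<k (lowered≤ (<⇒≤ 1<r₁)) })
    ≤-refl T≤N (Reaches-resp regroup (reach-A-lowered T≤N))
    where
    regroup : ∀ {k c} →
      Swept InA B-cells (lowered r₁ 1 T) k c ⇔ Swept InB (A-lowered T) (lowered r₂ r₁ N) k c
    regroup = mk⇔
      (λ { (inj₁ (b , e)) → inj₂ (b , trans e (sym (lowered-≤ (column≤N b)))) ; (inj₂ x) → inj₁ x })
      (λ { (inj₁ x) → inj₂ x ; (inj₂ (b , e)) → inj₁ (b , trans e (lowered-≤ (column≤N b))) })

  A-cell-to-bottom : ∀ {c} → InA c → ∃[ M ] (IsMinimal D₀ M × (1 , c) ∈ M)
  A-cell-to-bottom {c} a with reach-A-lowered z≤n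
  ... | rs , realises with minimal-below D₀ rs
  ...   | ss , minimal , _ = _ , minimal ,
    row1-applyMoves ss (Equivalence.from realises (inj₂ (a , sym (lowered-> (proj₂ (positive-cells a))))))

  A-cell-kept-raised : 1 < r₁ → ∀ {c T} → InA c → ¬ InB c → c ≤ T → Two (suc T) →
    ∃[ M ] (IsMinimal D₀ M × (1 , c) ∉ M)
  A-cell-kept-raised 1<r₁ {c} {T} a ¬b c≤T two
    with reach-AB-lowered 1<r₁ (<⇒≤ (column≤N (proj₁ two)))
  ... | rs , realises with minimal-below D₀ rs
  ...   | ss , minimal , stuck = _ , minimal , λ m →
    1+n≰n (subst (2 ≤_) (sym (∈⇒≡lo (profile LM) m one)) 2≤loM)
    where
    one : ¬ Two c
    one = ¬b ∘ proj₂
    LY : LowerProfile (applyMoves rs D₀) lo₀ hi₀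
    LY = Profile-applyMoves Profile₀ rs
    LM : LowerProfile (applyMoves ss (applyMoves rs D₀)) (lo′ LY) (hi′ LY)
    LM = Profile-applyMoves (profile LY) ss
    loY : r₁ ≡ lo′ LY c
    loY = ∈⇒≡lo (profile LY) (Equivalence.from realises (inj₁ (a , sym (lowered-≤ c≤T)))) one
    hiY≤r₁ : hi′ LY (suc T) ≤ r₁
    hiY≤r₁ with Equivalence.to realises (hi∈ (profile LY) (inj₁ (proj₁ two)))
    ... | inj₁ (_ , e) = subst (_≤ r₁) (sym e) (lowered≤ (<⇒≤ 1<r₁))
    ... | inj₂ (_ , e) = ≤-reflexive (trans e (lowered-> {r₂} ≤-refl))
    -- column suc T lies weakly below c, and still does so in the minimal element
    2≤loM : 2 ≤ lo′ LM c
    2≤loM = subst (_≤ lo′ LM c) (proj₂ (Stuck⇒Two-rows (profile LM) stuck two))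
              (keeps-below (lowering LM) (inj₁ a) one two (s≤s c≤T)
                (subst (hi′ LY (suc T) ≤_) loY hiY≤r₁))

  bounded⇒no-left : Bounded D₀ → 1 < r₁ → ColLeftEmpty D₀ r₁ r₂
  bounded⇒no-left ((_ , _ , unique-min) , _) 1<r₁ c ((a , ¬b) , suc T , two , s≤s c≤T) =
    let MX , minX , 1∈MX = A-cell-to-bottom a
        MY , minY , 1∉MY = A-cell-kept-raised 1<r₁ a ¬b c≤T two
    in 1∉MY (≈⇒⊆ (≈-sym (unique-min MY minY)) (≈⇒⊆ (unique-min MX minX) 1∈MX))

  bounded⇒condition : Bounded D₀ → Condition
  bounded⇒condition bounded with r₁ ≟ 1
  ... | yes r₁≡1 = inj₁ r₁≡1
  ... | no r₁≢1 = inj₂ (1<r₁ , bounded⇒no-left bounded 1<r₁)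
    where
    1<r₁ : 1 < r₁
    1<r₁ = ≤∧≢⇒< 1≤r₁ (r₁≢1 ∘ sym)

theorem5p5 : (D₀ : Diagram) (r₁ r₂ : ℕ) → TwoRowDiagram D₀ r₁ r₂ →
    Bounded D₀ ⇔ (r₁ ≡ 1 ⊎ (r₁ > 1 × ColLeftEmpty D₀ r₁ r₂))
theorem5p5 D₀ r₁ r₂ two-row = mk⇔ bounded⇒condition condition⇒bounded
  where open TwoRow D₀ r₁ r₂ two-row
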